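{- Let $p$ be an odd prime and $\alpha$ an integer with $\alpha^2+4\not\equiv 0\pmod p$. Define $F_0=0$, $F_1=1$, $F_{k+1}=\alpha F_k+F_{k-1}$ for $k\ge 1$ (the Fibonacci polynomials evaluated at $\alpha$). Let $K=\mathbb{F}_p(\sqrt{\alpha^2+4})$ (equal to $\mathbb{F}_p$ or $\mathbb{F}_{p^2}$), and in $K$ let \[ z_+=\frac{ -\alpha+\sqrt{\alpha^2+4}}{2},\qquad z_-=\frac{ -\alpha-\sqrt{\alpha^2+4}}{2}. \] Let $m\ge 1$ and $n>m$ be integers such that $F_nF_{m-1}\equiv F_{n-1}F_m\pmod p$, and such that no integer $k$ with $m<k<n$ satisfies $F_kF_{m-1}\equiv F_{k-1}F_m\pmod p$. Then $n-m$ equals the multiplicative order of $z_+/z_-$ in $K^{\times}$. -}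

module Defs where

open import Level using (_⊔_)
open import Data.Nat as ℕ using (ℕ; zero; suc)
open import Data.Integer as ℤ using (ℤ; +_; -[1+_])
open import Data.Product using (∃)
open import Relation.Nullary using (¬_)
open import Algebra.Bundles using (CommutativeRing)

F : ℤ → ℕ → ℤ
F α zero = + 0
F α (suc zero) = + 1
F α (suc (suc k)) = α ℤ.* F α (suc k) ℤ.+ F α k

_≡_[mod_] : ℤ → ℤ → ℕ → Set
a ≡ b [mod p ] = (+ p) Data.Integer.Divisibility.∣ (a ℤ.- b)
  where import Data.Integer.Divisibility

module _ {c ℓ} (K : CommutativeRing c ℓ) where
  open CommutativeRing K

  IsField : Set (c ⊔ ℓ)
  IsField = (¬ (1# ≈ 0#)) × (∀ x → ¬ (x ≈ 0#) → ∃ λ y → x * y ≈ 1#)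
    where open import Data.Product using (_×_)

  ιℕ : ℕ → Carrier
  ιℕ zero = 0#
  ιℕ (suc n) = 1# + ιℕ n

  ι : ℤ → Carrier
  ι (+ n) = ιℕ n
  ι -[1+ n ] = - ιℕ (suc n)

  pow : Carrier → ℕ → Carrier
  pow x zero = 1#
  pow x (suc k) = x * pow x k

  IsMultOrder : Carrier → ℕ → Set ℓ
  IsMultOrder x k = (1 ℕ.≤ k) × (pow x k ≈ 1#)
                    × (∀ j → 1 ℕ.≤ j → j ℕ.< k → ¬ (pow x j ≈ 1#))
    where open import Data.Product using (_×_)

module Submission where

-- Put x = −z₊ and y = −z₋: they are the roots of X² − αX − 1, distinct because α² + 4 ≢ 0,
-- so Binet's formula (x − y) F k = xᵏ − yᵏ holds in K, where the integers act through their
-- image in characteristic p.  Writing k = m + j and w = x / y, it yields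
--   (x − y)² (F k F (m−1) − F (k−1) F m) = (xy)^(m−1) (x − y) yʲ (1 − wʲ),
-- and all prefactors are nonzero.  Hence the congruence at k holds exactly when wʲ = 1, and
-- the minimality of n says that n − m is the order of w.

open import Defs
open import Data.Nat as ℕ using (ℕ; zero; suc; _≤_; _<_; _∸_)
open import Data.Nat.Properties as ℕP using ()
open import Data.Nat.Divisibility as ℕD using (divides; _∣?_)
open import Data.Nat.Primality using (Prime; prime⇒irreducible)
open import Data.Nat.Coprimality using (Coprime; coprime-Bézout)
open import Data.Nat.GCD using (module Bézout)
open import Data.Integer as ℤ using (ℤ; +_; -[1+_]; _⊖_; sign; ∣_∣; _◃_)
open import Data.Integer.Properties as ℤP using ()
open import Data.Sign as Sign using (Sign)
open import Data.Maybe using (Maybe; just; nothing)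
open import Data.Product using (_,_; proj₁; proj₂)
open import Data.Sum using (inj₁; inj₂)
open import Data.Empty using (⊥-elim)
open import Function.Base using (_∘_)
open import Function.Bundles using (_⇔_; mk⇔; Equivalence)
open import Relation.Binary.PropositionalEquality as ≡ using (_≡_)
open import Relation.Nullary using (¬_; yes; no)
open import Algebra.Bundles using (CommutativeRing)
import Algebra.Solver.Ring.AlmostCommutativeRing as ACR
import Algebra.Solver.Ring as RingSolver

module IntegerEmbedding {c ℓ} (K : CommutativeRing c ℓ) where
  open CommutativeRing K
  open import Algebra.Properties.Ring ring public
  open import Algebra.Properties.Monoid.Mult +-monoid using (_×_; ×-homo-+)
  open import Algebra.Properties.Semiring.Mult semiring using (×1-homo-*)
  open import Algebra.Properties.CommutativeSemigroup +-commutativeSemigroup using (interchange)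
  open import Relation.Binary.Reasoning.Setoid setoid

  ιℕ′ : ℕ → Carrier
  ιℕ′ = ιℕ K

  ι′ : ℤ → Carrier
  ι′ = ι K

  ιℕ≡×1# : ∀ n → ιℕ′ n ≡ n × 1#
  ιℕ≡×1# zero = ≡.refl
  ιℕ≡×1# (suc n) = ≡.cong (λ t → 1# + t) (ιℕ≡×1# n)

  ιℕ-+ : ∀ m n → ιℕ′ (m ℕ.+ n) ≈ ιℕ′ m + ιℕ′ n
  ιℕ-+ m n rewrite ιℕ≡×1# (m ℕ.+ n) | ιℕ≡×1# m | ιℕ≡×1# n = ×-homo-+ 1# m n

  ιℕ-* : ∀ m n → ιℕ′ (m ℕ.* n) ≈ ιℕ′ m * ιℕ′ n
  ιℕ-* m n rewrite ιℕ≡×1# (m ℕ.* n) | ιℕ≡×1# m | ιℕ≡×1# n = ×1-homo-* m n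

  ι-⊖ : ∀ m n → ι′ (m ⊖ n) ≈ ιℕ′ m - ιℕ′ n
  ι-⊖ m zero = sym (trans (+-congˡ -0#≈0#) (+-identityʳ _))
  ι-⊖ zero (suc n) = sym (+-identityˡ _)
  ι-⊖ (suc m) (suc n) = begin
    ι′ (suc m ⊖ suc n)        ≡⟨ ≡.cong ι′ (ℤP.[1+m]⊖[1+n]≡m⊖n m n) ⟩
    ι′ (m ⊖ n)                ≈⟨ ι-⊖ m n ⟩
    ιℕ′ m - ιℕ′ n             ≈⟨ [x+a]-[x+b]≈a-b 1# (ιℕ′ m) (ιℕ′ n) ⟨
    ιℕ′ (suc m) - ιℕ′ (suc n) ∎
    where
    [x+a]-[x+b]≈a-b : ∀ x a b → (x + a) - (x + b) ≈ a - b
    [x+a]-[x+b]≈a-b x a b = begin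
      (x + a) + - (x + b)   ≈⟨ +-congˡ (-‿+-comm x b) ⟨
      (x + a) + (- x + - b) ≈⟨ interchange x a (- x) (- b) ⟩
      (x - x) + (a - b)     ≈⟨ +-congʳ (-‿inverseʳ x) ⟩
      0# + (a - b)          ≈⟨ +-identityˡ _ ⟩
      a - b                 ∎

  ιℕ[k*n]≈0 : ∀ {n} → ιℕ′ n ≈ 0# → ∀ k → ιℕ′ (k ℕ.* n) ≈ 0#
  ιℕ[k*n]≈0 {n} ιn≈0 k = trans (ιℕ-* k n) (trans (*-congˡ ιn≈0) (zeroʳ _))

  ιℕ[d+a]≈0⇒ιℕd≈0 : ∀ {d a b} → d ℕ.+ a ≡ b → ιℕ′ a ≈ 0# → ιℕ′ b ≈ 0# → ιℕ′ d ≈ 0#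
  ιℕ[d+a]≈0⇒ιℕd≈0 {d} {a} {b} d+a≡b ιa≈0 ιb≈0 = begin
    ιℕ′ d            ≈⟨ +-identityʳ _ ⟨
    ιℕ′ d + 0#       ≈⟨ +-congˡ ιa≈0 ⟨
    ιℕ′ d + ιℕ′ a    ≈⟨ ιℕ-+ d a ⟨
    ιℕ′ (d ℕ.+ a)    ≡⟨ ≡.cong ιℕ′ d+a≡b ⟩
    ιℕ′ b            ≈⟨ ιb≈0 ⟩
    0#               ∎

  ιℕ-Bézout : ∀ {d m n} → Bézout.Identity d m n → ιℕ′ m ≈ 0# → ιℕ′ n ≈ 0# → ιℕ′ d ≈ 0#
  ιℕ-Bézout {d} {m} {n} (Bézout.+- x y eq) ιm≈0 ιn≈0 =
    ιℕ[d+a]≈0⇒ιℕd≈0 {d} eq (ιℕ[k*n]≈0 {n} ιn≈0 y) (ιℕ[k*n]≈0 {m} ιm≈0 x)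
  ιℕ-Bézout {d} {m} {n} (Bézout.-+ x y eq) ιm≈0 ιn≈0 =
    ιℕ[d+a]≈0⇒ιℕd≈0 {d} eq (ιℕ[k*n]≈0 {m} ιm≈0 x) (ιℕ[k*n]≈0 {n} ιn≈0 y)

  ι-+ : ∀ i j → ι′ (i ℤ.+ j) ≈ ι′ i + ι′ j
  ι-+ (+ m) (+ n) = ιℕ-+ m n
  ι-+ (+ m) -[1+ n ] = ι-⊖ m (suc n)
  ι-+ -[1+ m ] (+ n) = trans (ι-⊖ n (suc m)) (+-comm _ _)
  ι-+ -[1+ m ] -[1+ n ] = begin
    - ιℕ′ (suc (suc (m ℕ.+ n)))  ≡⟨ ≡.cong (λ k → - ιℕ′ (suc k)) (ℕP.+-suc m n) ⟨
    - ιℕ′ (suc m ℕ.+ suc n)      ≈⟨ -‿cong (ιℕ-+ (suc m) (suc n)) ⟩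
    - (ιℕ′ (suc m) + ιℕ′ (suc n)) ≈⟨ -‿+-comm _ _ ⟨
    - ιℕ′ (suc m) + - ιℕ′ (suc n) ∎

  ι-neg : ∀ i → ι′ (ℤ.- i) ≈ - ι′ i
  ι-neg (+ zero) = sym -0#≈0#
  ι-neg (+ suc n) = refl
  ι-neg -[1+ n ] = sym (-‿involutive _)

  ι-* : ∀ i j → ι′ (i ℤ.* j) ≈ ι′ i * ι′ j
  ι-* i j = begin
    ι′ (sign i Sign.* sign j ◃ ∣ i ∣ ℕ.* ∣ j ∣)       ≈⟨ ι-◃ (sign i Sign.* sign j) (∣ i ∣ ℕ.* ∣ j ∣) ⟩
    signed (sign i Sign.* sign j) (ιℕ′ (∣ i ∣ ℕ.* ∣ j ∣)) ≈⟨ signed-cong (sign i Sign.* sign j) (ιℕ-* ∣ i ∣ ∣ j ∣) ⟩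
    signed (sign i Sign.* sign j) (ιℕ′ ∣ i ∣ * ιℕ′ ∣ j ∣) ≈⟨ signed-* (sign i) (sign j) _ _ ⟩
    signed (sign i) (ιℕ′ ∣ i ∣) * signed (sign j) (ιℕ′ ∣ j ∣) ≈⟨ *-cong (ι-sign i) (ι-sign j) ⟨
    ι′ i * ι′ j                                        ∎
    where
    signed : Sign → Carrier → Carrier
    signed Sign.+ x = x
    signed Sign.- x = - x

    signed-cong : ∀ s {x y} → x ≈ y → signed s x ≈ signed s y
    signed-cong Sign.+ x≈y = x≈y
    signed-cong Sign.- x≈y = -‿cong x≈y

    signed-* : ∀ s t x y → signed (s Sign.* t) (x * y) ≈ signed s x * signed t y
    signed-* Sign.+ Sign.+ x y = refl
    signed-* Sign.+ Sign.- x y = -‿distribʳ-* x y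
    signed-* Sign.- Sign.+ x y = -‿distribˡ-* x y
    signed-* Sign.- Sign.- x y = begin
      x * y         ≈⟨ -‿involutive _ ⟨
      - (- (x * y)) ≈⟨ -‿cong (-‿distribʳ-* x y) ⟩
      - (x * - y)   ≈⟨ -‿distribˡ-* x (- y) ⟩
      - x * - y     ∎

    ι-◃ : ∀ s n → ι′ (s ◃ n) ≈ signed s (ιℕ′ n)
    ι-◃ Sign.+ zero = refl
    ι-◃ Sign.- zero = sym -0#≈0#
    ι-◃ Sign.+ (suc n) = refl
    ι-◃ Sign.- (suc n) = refl

    ι-sign : ∀ i → ι′ i ≈ signed (sign i) (ιℕ′ ∣ i ∣)
    ι-sign (+ n) = refl
    ι-sign -[1+ n ] = refl

  ι-homomorphism : CommutativeRing.rawRing ℤP.+-*-commutativeRing ACR.-Raw-AlmostCommutative⟶ ACR.fromCommutativeRing K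
  ι-homomorphism = record
    { ⟦_⟧ = ι′ ; +-homo = ι-+ ; *-homo = ι-* ; -‿homo = ι-neg ; 0-homo = refl ; 1-homo = +-identityʳ 1# }

  ι-≟ : ∀ i j → Maybe (ι′ i ≈ ι′ j)
  ι-≟ i j with i ℤ.≟ j
  ... | yes ≡.refl = just refl
  ... | no _ = nothing

  open RingSolver _ _ ι-homomorphism ι-≟ public using (solve; _:=_; _:+_; _:*_; :-_; _:-_; con)

module Binet {c ℓ} (K : CommutativeRing c ℓ) where
  open CommutativeRing K
  open IntegerEmbedding K
  open import Algebra.Properties.CommutativeSemiring.Exp commutativeSemiring public
    using (_^_; ^-homo-*; ^-distrib-*; ^-congˡ)
  open import Relation.Binary.Reasoning.Setoid setoid

  pow≡^ : ∀ x k → pow K x k ≡ x ^ k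
  pow≡^ x zero = ≡.refl
  pow≡^ x (suc k) = ≡.cong (x *_) (pow≡^ x k)

  power-cross : ∀ x y c j →
    (x ^ suc (c ℕ.+ j) - y ^ suc (c ℕ.+ j)) * (x ^ c - y ^ c) - (x ^ (c ℕ.+ j) - y ^ (c ℕ.+ j)) * (x ^ suc c - y ^ suc c)
      ≈ (x * y) ^ c * (x - y) * (y ^ j - x ^ j)
  power-cross x y c j = begin
    (x * x ^ (c ℕ.+ j) - y * y ^ (c ℕ.+ j)) * (X - Y) - (x ^ (c ℕ.+ j) - y ^ (c ℕ.+ j)) * (x * X - y * Y)
      ≈⟨ +-cong (*-congʳ (+-cong (*-congˡ x^[c+j]≈) (-‿cong (*-congˡ y^[c+j]≈))))
                (-‿cong (*-congʳ (+-cong x^[c+j]≈ (-‿cong y^[c+j]≈)))) ⟩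
    (x * (X * U) - y * (Y * V)) * (X - Y) - (X * U - Y * V) * (x * X - y * Y)
      ≈⟨ solve 6 (λ x y X Y U V → (x :* (X :* U) :- y :* (Y :* V)) :* (X :- Y) :- (X :* U :- Y :* V) :* (x :* X :- y :* Y)
                                  := X :* Y :* (x :- y) :* (V :- U)) refl x y X Y U V ⟩
    X * Y * (x - y) * (V - U)
      ≈⟨ *-congʳ (*-congʳ (^-distrib-* x y c)) ⟨
    (x * y) ^ c * (x - y) * (V - U) ∎
    where
    X = x ^ c
    Y = y ^ c
    U = x ^ j
    V = y ^ j
    x^[c+j]≈ : x ^ (c ℕ.+ j) ≈ X * U
    x^[c+j]≈ = ^-homo-* x c j
    y^[c+j]≈ : y ^ (c ℕ.+ j) ≈ Y * V
    y^[c+j]≈ = ^-homo-* y c j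

  module _ (α : ℤ) {x y : Carrier} (x+y≈α : x + y ≈ ι′ α) (x*y≈-1 : x * y ≈ - 1#) where

    binet : ∀ k → (x - y) * ι′ (F α k) ≈ x ^ k - y ^ k
    binet zero = trans (zeroʳ _) (sym (-‿inverseʳ 1#))
    binet (suc zero) = trans (*-congˡ (+-identityʳ 1#))
      (trans (*-identityʳ _) (sym (+-cong (*-identityʳ x) (-‿cong (*-identityʳ y)))))
    binet (suc (suc k)) = begin
      (x - y) * ι′ (α ℤ.* F α (suc k) ℤ.+ F α k)
        ≈⟨ *-congˡ (trans (ι-+ (α ℤ.* F α (suc k)) (F α k)) (+-congʳ (ι-* α (F α (suc k))))) ⟩
      (x - y) * (ι′ α * ι′ (F α (suc k)) + ι′ (F α k))
        ≈⟨ solve 5 (λ x y a f₁ f₀ → (x :- y) :* (a :* f₁ :+ f₀) := a :* ((x :- y) :* f₁) :+ (x :- y) :* f₀)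
             refl x y (ι′ α) (ι′ (F α (suc k))) (ι′ (F α k)) ⟩
      ι′ α * ((x - y) * ι′ (F α (suc k))) + (x - y) * ι′ (F α k)
        ≈⟨ +-cong (*-cong (sym x+y≈α) (binet (suc k))) (trans (binet k) (trans (sym (*-identityˡ _)) (*-congʳ (sym -[x*y]≈1)))) ⟩
      (x + y) * (x * x ^ k - y * y ^ k) + - (x * y) * (x ^ k - y ^ k)
        ≈⟨ solve 4 (λ x y u v → (x :+ y) :* (x :* u :- y :* v) :+ :- (x :* y) :* (u :- v)
                                  := x :* (x :* u) :- y :* (y :* v)) refl x y (x ^ k) (y ^ k) ⟩
      x * (x * x ^ k) - y * (y * y ^ k) ∎
      where
      -[x*y]≈1 : - (x * y) ≈ 1#
      -[x*y]≈1 = trans (-‿cong x*y≈-1) (-‿involutive 1#)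

    cross-identity : ∀ c j →
      (x - y) * (x - y) * (ι′ (F α (suc c ℕ.+ j) ℤ.* F α c) - ι′ (F α (c ℕ.+ j) ℤ.* F α (suc c)))
        ≈ (x * y) ^ c * (x - y) * (y ^ j - x ^ j)
    cross-identity c j = begin
      (x - y) * (x - y) * (ι′ (F α (suc c ℕ.+ j) ℤ.* F α c) - ι′ (F α (c ℕ.+ j) ℤ.* F α (suc c)))
        ≈⟨ *-congˡ (+-cong (ι-* (F α (suc c ℕ.+ j)) (F α c)) (-‿cong (ι-* (F α (c ℕ.+ j)) (F α (suc c))))) ⟩
      (x - y) * (x - y) * (G (suc c ℕ.+ j) * G c - G (c ℕ.+ j) * G (suc c))
        ≈⟨ solve 5 (λ d a b e f → d :* d :* (a :* b :- e :* f) := (d :* a) :* (d :* b) :- (d :* e) :* (d :* f))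
             refl (x - y) (G (suc c ℕ.+ j)) (G c) (G (c ℕ.+ j)) (G (suc c)) ⟩
      (x - y) * G (suc c ℕ.+ j) * ((x - y) * G c) - (x - y) * G (c ℕ.+ j) * ((x - y) * G (suc c))
        ≈⟨ +-cong (*-cong (binet (suc c ℕ.+ j)) (binet c)) (-‿cong (*-cong (binet (c ℕ.+ j)) (binet (suc c)))) ⟩
      (x ^ suc (c ℕ.+ j) - y ^ suc (c ℕ.+ j)) * (x ^ c - y ^ c) - (x ^ (c ℕ.+ j) - y ^ (c ℕ.+ j)) * (x ^ suc c - y ^ suc c)
        ≈⟨ power-cross x y c j ⟩
      (x * y) ^ c * (x - y) * (y ^ j - x ^ j) ∎
      where
      G : ℕ → Carrier
      G k = ι′ (F α k)

module Field {c ℓ} (K : CommutativeRing c ℓ) (isField : IsField K) where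
  open CommutativeRing K
  open IntegerEmbedding K
  open Binet K
  open import Relation.Binary.Reasoning.Setoid setoid

  1≉0 : ¬ 1# ≈ 0#
  1≉0 = proj₁ isField

  x≉0∧x*y≈0⇒y≈0 : ∀ {x y} → ¬ x ≈ 0# → x * y ≈ 0# → y ≈ 0#
  x≉0∧x*y≈0⇒y≈0 {x} {y} x≉0 x*y≈0 with proj₂ isField x x≉0
  ... | x⁻¹ , x*x⁻¹≈1 = begin
    y              ≈⟨ *-identityˡ y ⟨
    1# * y         ≈⟨ *-congʳ x*x⁻¹≈1 ⟨
    (x * x⁻¹) * y  ≈⟨ solve 3 (λ x x⁻¹ y → (x :* x⁻¹) :* y := x⁻¹ :* (x :* y)) refl x x⁻¹ y ⟩
    x⁻¹ * (x * y)  ≈⟨ *-congˡ x*y≈0 ⟩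
    x⁻¹ * 0#       ≈⟨ zeroʳ x⁻¹ ⟩
    0#             ∎

  x*y≉0 : ∀ {x y} → ¬ x ≈ 0# → ¬ y ≈ 0# → ¬ x * y ≈ 0#
  x*y≉0 x≉0 y≉0 x*y≈0 = y≉0 (x≉0∧x*y≈0⇒y≈0 x≉0 x*y≈0)

  x^n≉0 : ∀ {x} n → ¬ x ≈ 0# → ¬ x ^ n ≈ 0#
  x^n≉0 zero x≉0 = 1≉0
  x^n≉0 (suc n) x≉0 = x*y≉0 x≉0 (x^n≉0 n x≉0)

  *-cancelˡ : ∀ {k x y} → ¬ k ≈ 0# → k * x ≈ k * y → x ≈ y
  *-cancelˡ {k} {x} {y} k≉0 k*x≈k*y = x∙y⁻¹≈ε⇒x≈y x y (x≉0∧x*y≈0⇒y≈0 k≉0 (begin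
    k * (x - y)    ≈⟨ x[y-z]≈xy-xz k x y ⟩
    k * x - k * y  ≈⟨ x≈y⇒x∙y⁻¹≈ε k*x≈k*y ⟩
    0#             ∎))

  scaled-≈0⇔≈0 : ∀ {a b t u} → ¬ a ≈ 0# → ¬ b ≈ 0# → a * t ≈ b * u → t ≈ 0# ⇔ u ≈ 0#
  scaled-≈0⇔≈0 {a} {b} {t} {u} a≉0 b≉0 a*t≈b*u = mk⇔
    (λ t≈0 → x≉0∧x*y≈0⇒y≈0 b≉0 (trans (sym a*t≈b*u) (trans (*-congˡ t≈0) (zeroʳ a))))
    (λ u≈0 → x≉0∧x*y≈0⇒y≈0 a≉0 (trans a*t≈b*u (trans (*-congˡ u≈0) (zeroʳ b))))

  x-y≈0⇔x≈y : ∀ {x y} → x - y ≈ 0# ⇔ x ≈ y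
  x-y≈0⇔x≈y = mk⇔ (x∙y⁻¹≈ε⇒x≈y _ _) x≈y⇒x∙y⁻¹≈ε

  module QuadraticRoots (α : ℤ) {s z₊ z₋ : Carrier} (2≉0 : ¬ ι′ (+ 2) ≈ 0#)
    (s*s≈ : s * s ≈ ι′ (α ℤ.* α ℤ.+ + 4))
    (2z₊≈ : ι′ (+ 2) * z₊ ≈ ι′ (ℤ.- α) + s) (2z₋≈ : ι′ (+ 2) * z₋ ≈ ι′ (ℤ.- α) - s) where

    private
      a two : Carrier
      a = ι′ α
      two = ι′ (+ 2)

      2z₊≈-a+s : two * z₊ ≈ - a + s
      2z₊≈-a+s = trans 2z₊≈ (+-congʳ (ι-neg α))

      2z₋≈-a-s : two * z₋ ≈ - a - s
      2z₋≈-a-s = trans 2z₋≈ (+-congʳ (ι-neg α))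

    roots-sum : - z₊ + - z₋ ≈ a
    roots-sum = *-cancelˡ 2≉0 (begin
      two * (- z₊ + - z₋)          ≈⟨ solve 2 (λ z₊ z₋ → con (+ 2) :* (:- z₊ :+ :- z₋) := :- (con (+ 2) :* z₊ :+ con (+ 2) :* z₋)) refl z₊ z₋ ⟩
      - (two * z₊ + two * z₋)      ≈⟨ -‿cong (+-cong 2z₊≈-a+s 2z₋≈-a-s) ⟩
      - ((- a + s) + (- a - s))    ≈⟨ solve 2 (λ a s → :- ((:- a :+ s) :+ (:- a :- s)) := con (+ 2) :* a) refl a s ⟩
      two * a                      ∎)

    roots-product : - z₊ * - z₋ ≈ - 1#
    roots-product = *-cancelˡ (x*y≉0 2≉0 2≉0) (begin
      two * two * (- z₊ * - z₋)     ≈⟨ solve 2 (λ z₊ z₋ → con (+ 2) :* con (+ 2) :* (:- z₊ :* :- z₋) := (con (+ 2) :* z₊) :* (con (+ 2) :* z₋)) refl z₊ z₋ ⟩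
      (two * z₊) * (two * z₋)       ≈⟨ *-cong 2z₊≈-a+s 2z₋≈-a-s ⟩
      (- a + s) * (- a - s)         ≈⟨ solve 2 (λ a s → (:- a :+ s) :* (:- a :- s) := a :* a :- s :* s) refl a s ⟩
      a * a - s * s                 ≈⟨ +-congˡ (-‿cong (trans s*s≈ (trans (ι-+ (α ℤ.* α) (+ 4)) (+-congʳ (ι-* α α))))) ⟩
      a * a - (a * a + ι′ (+ 4))    ≈⟨ solve 1 (λ a → a :* a :- (a :* a :+ con (+ 4)) := con (+ 2) :* con (+ 2) :* :- con (+ 1)) refl a ⟩
      two * two * - ι′ (+ 1)        ≈⟨ *-congˡ (-‿cong (+-identityʳ 1#)) ⟩
      two * two * - 1#              ∎)

    roots-difference : - z₊ - - z₋ ≈ - s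
    roots-difference = *-cancelˡ 2≉0 (begin
      two * (- z₊ - - z₋)           ≈⟨ solve 2 (λ z₊ z₋ → con (+ 2) :* (:- z₊ :- :- z₋) := con (+ 2) :* z₋ :- con (+ 2) :* z₊) refl z₊ z₋ ⟩
      two * z₋ - two * z₊           ≈⟨ +-cong 2z₋≈-a-s (-‿cong 2z₊≈-a+s) ⟩
      (- a - s) - (- a + s)         ≈⟨ solve 2 (λ a s → (:- a :- s) :- (:- a :+ s) := con (+ 2) :* :- s) refl a s ⟩
      two * - s                     ∎)

    roots-distinct : ¬ ι′ (α ℤ.* α ℤ.+ + 4) ≈ 0# → ¬ - z₊ - - z₋ ≈ 0#
    roots-distinct disc≉0 x-y≈0 = disc≉0 (begin
      ι′ (α ℤ.* α ℤ.+ + 4)  ≈⟨ s*s≈ ⟨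
      s * s                 ≈⟨ *-cong s≈0 s≈0 ⟩
      0# * 0#               ≈⟨ zeroˡ 0# ⟩
      0#                    ∎)
      where
      s≈0 : s ≈ 0#
      s≈0 = -‿injective (trans (sym roots-difference) (trans x-y≈0 (sym -0#≈0#)))

  module _ (α : ℤ) {x y w : Carrier} (x+y≈α : x + y ≈ ι′ α) (x*y≈-1 : x * y ≈ - 1#)
           (x-y≉0 : ¬ x - y ≈ 0#) (w*y≈x : w * y ≈ x) where

    cross≈⇔w^j≈1 : ∀ c j →
      ι′ (F α (suc c ℕ.+ j) ℤ.* F α c) ≈ ι′ (F α (c ℕ.+ j) ℤ.* F α (suc c)) ⇔ w ^ j ≈ 1#
    cross≈⇔w^j≈1 c j = mk⇔
      (λ A≈B → sym (to x-y≈0⇔x≈y (to vanish (from x-y≈0⇔x≈y A≈B))))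
      (λ w^j≈1 → to x-y≈0⇔x≈y (from vanish (from x-y≈0⇔x≈y (sym w^j≈1))))
      where
      open Equivalence
      A B : Carrier
      A = ι′ (F α (suc c ℕ.+ j) ℤ.* F α c)
      B = ι′ (F α (c ℕ.+ j) ℤ.* F α (suc c))

      xy≉0 : ¬ x * y ≈ 0#
      xy≉0 xy≈0 = 1≉0 (-‿injective (trans (sym x*y≈-1) (trans xy≈0 (sym -0#≈0#))))

      y≉0 : ¬ y ≈ 0#
      y≉0 y≈0 = xy≉0 (trans (*-congˡ y≈0) (zeroʳ x))

      y^j-x^j≈ : y ^ j - x ^ j ≈ y ^ j * (1# - w ^ j)
      y^j-x^j≈ = begin
        y ^ j - x ^ j              ≈⟨ +-congˡ (-‿cong (^-congˡ j w*y≈x)) ⟨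
        y ^ j - (w * y) ^ j        ≈⟨ +-congˡ (-‿cong (trans (^-distrib-* w y j) (*-comm _ _))) ⟩
        y ^ j - y ^ j * w ^ j      ≈⟨ +-congʳ (*-identityʳ _) ⟨
        y ^ j * 1# - y ^ j * w ^ j ≈⟨ x[y-z]≈xy-xz (y ^ j) 1# (w ^ j) ⟨
        y ^ j * (1# - w ^ j)       ∎

      scaled : (x - y) * (x - y) * (A - B) ≈ (x * y) ^ c * (x - y) * y ^ j * (1# - w ^ j)
      scaled = begin
        (x - y) * (x - y) * (A - B)                 ≈⟨ cross-identity α x+y≈α x*y≈-1 c j ⟩
        (x * y) ^ c * (x - y) * (y ^ j - x ^ j)     ≈⟨ *-congˡ y^j-x^j≈ ⟩
        (x * y) ^ c * (x - y) * (y ^ j * (1# - w ^ j)) ≈⟨ *-assoc _ _ _ ⟨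
        (x * y) ^ c * (x - y) * y ^ j * (1# - w ^ j) ∎

      vanish : A - B ≈ 0# ⇔ 1# - w ^ j ≈ 0#
      vanish = scaled-≈0⇔≈0 (x*y≉0 x-y≉0 x-y≉0)
        (x*y≉0 (x*y≉0 (x^n≉0 c xy≉0) x-y≉0) (x^n≉0 j y≉0))
        scaled

  module Characteristic (p : ℕ) (p-prime : Prime p) (ιp≈0 : ι′ (+ p) ≈ 0#) where

    ∣⇒ιℕ≈0 : ∀ {n} → p ℕD.∣ n → ιℕ′ n ≈ 0#
    ∣⇒ιℕ≈0 (divides k ≡.refl) = ιℕ[k*n]≈0 ιp≈0 k

    ιℕ≈0⇒∣ : ∀ {n} → ιℕ′ n ≈ 0# → p ℕD.∣ n
    ιℕ≈0⇒∣ {n} ιn≈0 with p ∣? n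
    ... | yes p∣n = p∣n
    ... | no p∤n = ⊥-elim (1≉0 (trans (sym (+-identityʳ 1#)) (ιℕ-Bézout (coprime-Bézout p⊥n) ιp≈0 ιn≈0)))
      where
      p⊥n : Coprime p n
      p⊥n (d∣p , d∣n) with prime⇒irreducible p-prime d∣p
      ... | inj₁ d≡1 = d≡1
      ... | inj₂ ≡.refl = ⊥-elim (p∤n d∣n)

    ι≈0⇔∣ : ∀ i → ι′ i ≈ 0# ⇔ p ℕD.∣ ∣ i ∣
    ι≈0⇔∣ (+ n) = mk⇔ ιℕ≈0⇒∣ ∣⇒ιℕ≈0
    ι≈0⇔∣ -[1+ n ] = mk⇔
      (λ -ιn≈0 → ιℕ≈0⇒∣ (-‿injective (trans -ιn≈0 (sym -0#≈0#))))
      (λ p∣n → trans (-‿cong (∣⇒ιℕ≈0 p∣n)) -0#≈0#)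

    ≡[mod]⇔ι≈ : ∀ a b → a ≡ b [mod p ] ⇔ ι′ a ≈ ι′ b
    ≡[mod]⇔ι≈ a b = mk⇔
      (λ p∣a-b → Equivalence.to x-y≈0⇔x≈y (trans (sym ι[a-b]≈) (Equivalence.from (ι≈0⇔∣ (a ℤ.- b)) p∣a-b)))
      (λ ιa≈ιb → Equivalence.to (ι≈0⇔∣ (a ℤ.- b)) (trans ι[a-b]≈ (Equivalence.from x-y≈0⇔x≈y ιa≈ιb)))
      where
      ι[a-b]≈ : ι′ (a ℤ.- b) ≈ ι′ a - ι′ b
      ι[a-b]≈ = trans (ι-+ a (ℤ.- b)) (+-congˡ (ι-neg b))

    2≉0 : 2 < p → ¬ ι′ (+ 2) ≈ 0#
    2≉0 2<p ι2≈0 = ℕP.<⇒≱ 2<p (ℕD.∣⇒≤ (ιℕ≈0⇒∣ ι2≈0))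

isMultOrder-offset : ∀ {c ℓ} (K : CommutativeRing c ℓ) {w : CommutativeRing.Carrier K} (P : ℕ → Set) {m n : ℕ}
  → m < n → (∀ j → P (m ℕ.+ j) ⇔ CommutativeRing._≈_ K (pow K w j) (CommutativeRing.1# K))
  → P n → (∀ k → m < k → k < n → ¬ P k) → IsMultOrder K w (n ∸ m)
isMultOrder-offset K P {m} {n} m<n P⇔w^j≈1 Pn minimal =
  ℕP.m<n⇒0<n∸m m<n ,
  Equivalence.to (P⇔w^j≈1 (n ∸ m)) (≡.subst P (≡.sym m+[n∸m]≡n) Pn) ,
  λ j 1≤j j<n∸m w^j≈1 → minimal (m ℕ.+ j) (ℕP.m<m+n m 1≤j)
    (≡.subst (m ℕ.+ j <_) m+[n∸m]≡n (ℕP.+-monoʳ-< m j<n∸m))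
    (Equivalence.from (P⇔w^j≈1 j) w^j≈1)
  where
  m+[n∸m]≡n : m ℕ.+ (n ∸ m) ≡ n
  m+[n∸m]≡n = ℕP.m+[n∸m]≡n (ℕP.<⇒≤ m<n)

open import Data.Integer using (_*_; _+_; -_)
open import Function.Properties.Equivalence using () renaming (refl to ⇔-refl; trans to ⇔-trans)

lemma4p4 : ∀ {c ℓ} (p : ℕ) → Prime p → 2 < p → (α : ℤ)
    → ¬ ((α * α + + 4) ≡ + 0 [mod p ])
    → (K : CommutativeRing c ℓ) → IsField K
    → CommutativeRing._≈_ K (ι K (+ p)) (CommutativeRing.0# K)
    → (s : CommutativeRing.Carrier K)
    → CommutativeRing._≈_ K (CommutativeRing._*_ K s s) (ι K (α * α + + 4))
    → (z₊ z₋ w : CommutativeRing.Carrier K)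
    → CommutativeRing._≈_ K (CommutativeRing._*_ K (ι K (+ 2)) z₊) (CommutativeRing._+_ K (ι K (- α)) s)
    → CommutativeRing._≈_ K (CommutativeRing._*_ K (ι K (+ 2)) z₋) (CommutativeRing._-_ K (ι K (- α)) s)
    → CommutativeRing._≈_ K (CommutativeRing._*_ K w z₋) z₊
    → (m n : ℕ) → 1 ≤ m → m < n
    → (F α n * F α (m ∸ 1)) ≡ (F α (n ∸ 1) * F α m) [mod p ]
    → (∀ k → m < k → k < n → ¬ ((F α k * F α (m ∸ 1)) ≡ (F α (k ∸ 1) * F α m) [mod p ]))
    → IsMultOrder K w (n ∸ m)
lemma4p4 p p-prime 2<p α p∤α²+4 K isField ιp≈0 s s*s≈ z₊ z₋ w 2z₊≈ 2z₋≈ w*z₋≈z₊ (suc c) n _ m<n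
  = isMultOrder-offset K P m<n P⇔w^j≈1
  where
  module K = CommutativeRing K
  open K using (_≈_; 1#)
  open IntegerEmbedding K using (-‿distribʳ-*)
  open Binet K using (pow≡^)
  open Field K isField
  open Characteristic p p-prime ιp≈0
  open QuadraticRoots α (2≉0 2<p) s*s≈ 2z₊≈ 2z₋≈

  P : ℕ → Set
  P k = (F α k * F α c) ≡ (F α (k ∸ 1) * F α (suc c)) [mod p ]

  roots-ratio : w K.* (K.- z₋) ≈ K.- z₊
  roots-ratio = K.trans (K.sym (-‿distribʳ-* w z₋)) (K.-‿cong w*z₋≈z₊)

  disc≉0 : ¬ ι K (α * α + + 4) ≈ K.0#
  disc≉0 = p∤α²+4 ∘ Equivalence.from (≡[mod]⇔ι≈ (α * α + + 4) (+ 0))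

  P⇔w^j≈1 : ∀ j → P (suc c ℕ.+ j) ⇔ pow K w j ≈ 1#
  P⇔w^j≈1 j = ⇔-trans (≡[mod]⇔ι≈ (F α (suc c ℕ.+ j) * F α c) (F α (c ℕ.+ j) * F α (suc c))) (⇔-trans
    (cross≈⇔w^j≈1 α roots-sum roots-product (roots-distinct disc≉0) roots-ratio c j)
    (≡.subst (λ t → (t ≈ 1#) ⇔ (pow K w j ≈ 1#)) (pow≡^ w j) ⇔-refl))
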